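{- Let $G$ be a unicyclic graph on $n$ vertices with girth $g$, and suppose $|C_G|=r\geq 2$. Then: (a) if $n\geq 2g-1$, there exist two distinct vertices $i,j\in C_G$ with $l_i\geq d(i,j)$; (b) if $n\geq 3g-1$, there exist two distinct vertices $i,j\in C_G$ with $l_i\geq 2d(i,j)$.
   Context: Graphs are finite, simple, connected. A unicyclic graph has exactly one cycle; its length is the girth $g$. Label the vertices on the cycle $1,\dots,g$; for each cycle vertex $i$, $l_i$ is the number of vertices (other than $i$) of the tree attached to $i$, i.e. of the connected component containing $i$ after deleting the cycle edges, minus one. Thus $l_1+\cdots+l_g=n-g$. $C_G$ is the set of cycle vertices $i$ with $l_i\geq1$. $d(u,v)$ is the distance in $G$. -}

module Defs where

open import Data.Nat using (ℕ; zero; suc; _+_; _*_; _∸_; _≤_; _≤?_)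
open import Data.Fin using (Fin; toℕ)
open import Data.List using (List; length; filter; allFin)
open import Data.List.Membership.Propositional using (_∈_)
open import Data.List.Relation.Unary.Unique.Propositional using (Unique)
open import Data.Product using (Σ; ∃; _×_; _,_)
open import Data.Sum using (_⊎_)
open import Relation.Nullary using (¬_)
open import Relation.Binary.PropositionalEquality using (_≡_; _≢_)
open import Function.Definitions using (Injective)

record Graph (n : ℕ) : Set₁ where
  field
    Adj    : Fin n → Fin n → Set
    sym    : ∀ {u v} → Adj u v → Adj v u
    irrefl : ∀ {u} → ¬ Adj u u
open Graph public

data Walk {n : ℕ} (R : Fin n → Fin n → Set) : Fin n → Fin n → ℕ → Set where
  nil  : ∀ {u} → Walk R u u zero
  cons : ∀ {u w v k} → R u w → Walk R w v k → Walk R u v (suc k)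

Reach : ∀ {n} → (Fin n → Fin n → Set) → Fin n → Fin n → Set
Reach R u v = ∃ λ k → Walk R u v k

Connected : ∀ {n} → Graph n → Set
Connected G = ∀ u v → Reach (Adj G) u v

Dist : ∀ {n} → Graph n → Fin n → Fin n → ℕ → Set
Dist G u v k = Walk (Adj G) u v k × (∀ m → Walk (Adj G) u v m → k ≤ m)

-- Consecutive positions on a cycle with positions 0,…,g-1 (i.e. labels 1,…,g).
CycAdj : ∀ {g} → Fin g → Fin g → Set
CycAdj {g} i j = (toℕ j ≡ suc (toℕ i)) ⊎ ((toℕ i ≡ g ∸ 1) × (toℕ j ≡ 0))

IsCycle : ∀ {n} → Graph n → (g : ℕ) → (Fin g → Fin n) → Set
IsCycle G g c = (3 ≤ g) × Injective _≡_ _≡_ c × (∀ i j → CycAdj i j → Adj G (c i) (c j))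

CycleEdge : ∀ {n g} → (Fin g → Fin n) → Fin n → Fin n → Set
CycleEdge c u v = ∃ λ i → ∃ λ j → CycAdj i j ×
  (((u ≡ c i) × (v ≡ c j)) ⊎ ((u ≡ c j) × (v ≡ c i)))

-- G is unicyclic with unique cycle c of length g: G is connected, c is a
-- cycle, and every cycle of G has all its edges among the edges of c
-- (so, as a subgraph, every cycle of G equals c).
IsUnicyclicWith : ∀ {n} → Graph n → (g : ℕ) → (Fin g → Fin n) → Set
IsUnicyclicWith {n} G g c =
  Connected G × IsCycle G g c ×
  (∀ (g' : ℕ) (c' : Fin g' → Fin n) → IsCycle G g' c' →
     ∀ i j → CycAdj i j → CycleEdge c (c' i) (c' j))

AdjMinusCycle : ∀ {n g} → Graph n → (Fin g → Fin n) → Fin n → Fin n → Set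
AdjMinusCycle G c u v = Adj G u v × ¬ CycleEdge c u v

-- The component of c i after deleting the cycle edges has exactly m + 1
-- vertices, i.e. l_i = m.
TreeSize : ∀ {n g} → Graph n → (Fin g → Fin n) → Fin g → ℕ → Set
TreeSize {n} G c i m = Σ (List (Fin n)) λ xs →
  Unique xs × (∀ v → (v ∈ xs → Reach (AdjMinusCycle G c) (c i) v)
                   × (Reach (AdjMinusCycle G c) (c i) v → v ∈ xs))
  × (length xs ≡ suc m)

-- |C_G| : the number of cycle positions i with l_i ≥ 1.
cardC : ∀ {g} → (Fin g → ℕ) → ℕ
cardC {g} l = length (filter (λ i → 1 ≤? l i) (allFin g))

module Submission where

-- No path avoiding the cycle edges joins
--     two distinct cycle vertices, since a shortest such path would close a
--     second cycle.  So a walk can only pass between the trees hanging off the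
--     cycle along cycle edges, and d(c i, c j) = cyc i j.
--  2. Vertex count (module Trees).  The trees cover G, so n ≤ Σ l_i + g.
--  3. Arc packing (modules ArcPacking, Counting).  If every two members of
--     C_G are further apart than h(l_i), the forward arcs of h(l_i) + 1
--     positions starting at the members are disjoint, so Σ (h(l_i) + 1) ≤ g.
--     When l < K (h(l) + 1), this gives Σ l_i + |C_G| ≤ K g and with step 2
--     n + |C_G| ≤ (K + 1) g, contradicting n ≥ (K + 1) g - 1 and |C_G| ≥ 2.
-- Part (a) is the case h(x) = x, K = 1; part (b) the case h(x) = ⌊x/2⌋, K = 2.
-- Cyclic arithmetic on positions is developed first (CyclicShift, CycleDistance),
-- and generic facts about walks and list counting are collected before use.

open import Data.Nat
open import Data.Nat.Properties
open import Data.List using (List; []; _∷_; length; map; concat; filter; upTo; applyUpTo; allFin)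
open import Data.List.Properties using (length-++; length-applyUpTo; length-tabulate; map-cong)
open import Data.Nat.ListAction using (sum)
open import Data.List.Membership.Propositional using (_∈_)
open import Data.List.Membership.Propositional.Properties
  using (∈-map⁻; ∈-map⁺; ∈-upTo⁺; ∈-applyUpTo⁻; ∈-concat⁻′; ∈-concat⁺′; ∈-allFin; ∈-filter⁻)
open import Data.List.Relation.Unary.Any using (here; there)
open import Data.List.Relation.Unary.All as All using (All; []; _∷_)
import Data.List.Relation.Unary.All.Properties as Allₚ
open import Data.List.Relation.Unary.AllPairs as AllPairs using ([]; _∷_)
import Data.List.Relation.Unary.AllPairs.Properties as AllPairsₚ
open import Data.List.Relation.Unary.Unique.Propositional using (Unique)
open import Data.List.Relation.Unary.Unique.Propositional.Properties using (concat⁺; applyUpTo⁺₁; allFin⁺; filter⁺)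
open import Data.List.Relation.Binary.Disjoint.Propositional using (Disjoint)
open import Data.Sum using (_⊎_; inj₁; inj₂)
open import Data.Product using (∃; _×_; _,_; proj₁; proj₂)
open import Data.Empty using (⊥; ⊥-elim)
open import Relation.Nullary using (yes; no; Dec)
open import Relation.Unary using (Decidable)
open import Relation.Nullary.Decidable using (_×-dec_; _⊎-dec_; ¬?; decidable-stable)
open import Induction.WellFounded using (WfRec)
open import Data.Nat.Induction using (<-rec)
open import Function.Definitions using (Injective)
open import Relation.Binary.PropositionalEquality
open import Relation.Binary.Definitions using (tri<; tri≈; tri>)
open import Data.Fin using (Fin; toℕ; fromℕ<) renaming (_≟_ to _≟ᶠ_)
open import Data.Fin.Properties using (toℕ<n; toℕ-injective; toℕ-fromℕ<; any?)
open import Defs hiding (sym)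

-- Positions on a cycle of length g are the naturals below g.  'Forward x y s'
-- says that s < g steps forward around the cycle lead from x to y, i.e.
-- x + s ≡ y modulo g, with the wrap-around made explicit.
module CyclicShift (g : ℕ) where

  Forward : ℕ → ℕ → ℕ → Set
  Forward x y s = s < g × (x + s ≡ y ⊎ x + s ≡ y + g)

  no-wrap : ∀ {a b} → b < g → a + g ≢ b
  no-wrap {a} b<g eq = <⇒≱ b<g (≤-trans (m≤n+m g a) (≤-reflexive eq))

  +-swap-g : ∀ x s → x + s + g ≡ x + g + s
  +-swap-g x s = trans (+-assoc x s g) (trans (cong (x +_) (+-comm s g)) (sym (+-assoc x g s)))

  shift : ℕ → ℕ → ℕ
  shift x t with x + t <? g
  ... | yes _ = x + t
  ... | no _  = x + t ∸ g

  shift-forward : ∀ {x t} → x < g → t < g → shift x t < g × Forward x (shift x t) t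
  shift-forward {x} {t} x<g t<g with x + t <? g
  ... | yes x+t<g = x+t<g , t<g , inj₁ refl
  ... | no x+t≮g  = wrapped<g , t<g , inj₂ (sym (m∸n+n≡m (≮⇒≥ x+t≮g)))
    where
    wrapped<g : x + t ∸ g < g
    wrapped<g = +-cancelʳ-< _ _ g
      (subst (_< g + g) (sym (m∸n+n≡m (≮⇒≥ x+t≮g))) (+-mono-< x<g t<g))

  forward-exists : ∀ {x y} → x < g → y < g → ∃ λ s → Forward x y s
  forward-exists {x} {y} x<g y<g with x ≤? y
  ... | yes x≤y = y ∸ x , ≤-<-trans (m∸n≤m y x) y<g , inj₁ (m+[n∸m]≡n x≤y)
  ... | no x≰y  = g ∸ x + y , around<g , inj₂ around
    where
    around<g : g ∸ x + y < g
    around<g = subst (g ∸ x + y <_) (m∸n+n≡m (<⇒≤ x<g)) (+-monoʳ-< (g ∸ x) (≰⇒> x≰y))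
    around : x + (g ∸ x + y) ≡ y + g
    around = begin
      x + (g ∸ x + y)  ≡⟨ sym (+-assoc x (g ∸ x) y) ⟩
      x + (g ∸ x) + y  ≡⟨ cong (_+ y) (m+[n∸m]≡n (<⇒≤ x<g)) ⟩
      g + y            ≡⟨ +-comm g y ⟩
      y + g            ∎
      where open ≡-Reasoning

  forward-steps-unique : ∀ {x y s s'} → Forward x y s → Forward x y s' → s ≡ s'
  forward-steps-unique {x} (_ , inj₁ e) (_ , inj₁ e') = +-cancelˡ-≡ x _ _ (trans e (sym e'))
  forward-steps-unique {x} (_ , inj₂ e) (_ , inj₂ e') = +-cancelˡ-≡ x _ _ (trans e (sym e'))
  forward-steps-unique {x} {s = s} {s'} (_ , inj₁ e) (s'<g , inj₂ e') =
    ⊥-elim (no-wrap s'<g (+-cancelˡ-≡ x _ _ (trans (sym (+-assoc x s g)) (trans (cong (_+ g) e) (sym e')))))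
  forward-steps-unique {x} {s = s} {s'} (s<g , inj₂ e) (_ , inj₁ e') =
    ⊥-elim (no-wrap s<g (+-cancelˡ-≡ x _ _ (trans (sym (+-assoc x s' g)) (trans (cong (_+ g) e') (sym e)))))

  forward-target-unique : ∀ {x y y' s} → y < g → y' < g → Forward x y s → Forward x y' s → y ≡ y'
  forward-target-unique _ _ (_ , inj₁ e) (_ , inj₁ e') = trans (sym e) e'
  forward-target-unique _ _ (_ , inj₂ e) (_ , inj₂ e') = +-cancelʳ-≡ _ _ _ (trans (sym e) e')
  forward-target-unique y<g _ (_ , inj₁ e) (_ , inj₂ e') = ⊥-elim (no-wrap y<g (trans (sym e') e))
  forward-target-unique _ y'<g (_ , inj₂ e) (_ , inj₁ e') = ⊥-elim (no-wrap y'<g (trans (sym e) e'))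

  forward-source-unique : ∀ {x x' y s} → x < g → x' < g → Forward x y s → Forward x' y s → x ≡ x'
  forward-source-unique _ _ (_ , inj₁ e) (_ , inj₁ e') = +-cancelʳ-≡ _ _ _ (trans e (sym e'))
  forward-source-unique _ _ (_ , inj₂ e) (_ , inj₂ e') = +-cancelʳ-≡ _ _ _ (trans e (sym e'))
  forward-source-unique {x} {x'} {s = s} _ x'<g (_ , inj₁ e) (_ , inj₂ e') =
    ⊥-elim (no-wrap x'<g (+-cancelʳ-≡ s _ _ (trans (sym (+-swap-g x s)) (trans (cong (_+ g) e) (sym e')))))
  forward-source-unique {x} {x'} {s = s} x<g _ (_ , inj₂ e) (_ , inj₁ e') =
    ⊥-elim (no-wrap x<g (+-cancelʳ-≡ s _ _ (trans (sym (+-swap-g x' s)) (trans (cong (_+ g) e') (sym e)))))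

  forward-zero : ∀ {x} → 0 < g → Forward x x 0
  forward-zero {x} 0<g = 0<g , inj₁ (+-identityʳ x)

  forward-zero⁻ : ∀ {x y} → x < g → Forward x y 0 → x ≡ y
  forward-zero⁻ {x} _ (_ , inj₁ e) = trans (sym (+-identityʳ x)) e
  forward-zero⁻ {x} x<g (_ , inj₂ e) = ⊥-elim (no-wrap x<g (sym (trans (sym (+-identityʳ x)) e)))

  forward-compose : ∀ {x y z s t} → x < g → Forward x y s → Forward y z t → s + t < g →
    Forward x z (s + t)
  forward-compose {x} {y} {z} {s} {t} x<g (_ , xy) (_ , yz) s+t<g = s+t<g , combine xy yz
    where
    reassoc : x + (s + t) ≡ x + s + t
    reassoc = sym (+-assoc x s t)
    combine : (x + s ≡ y ⊎ x + s ≡ y + g) → (y + t ≡ z ⊎ y + t ≡ z + g) →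
      (x + (s + t) ≡ z ⊎ x + (s + t) ≡ z + g)
    combine (inj₁ a) (inj₁ b) = inj₁ (trans reassoc (trans (cong (_+ t) a) b))
    combine (inj₁ a) (inj₂ b) = inj₂ (trans reassoc (trans (cong (_+ t) a) b))
    combine (inj₂ a) (inj₁ b) =
      inj₂ (trans reassoc (trans (cong (_+ t) a) (trans (sym (+-swap-g y t)) (cong (_+ g) b))))
    combine (inj₂ a) (inj₂ b) =
      ⊥-elim (<⇒≱ (+-mono-< x<g s+t<g) (≤-trans (m≤n+m (g + g) z) (≤-reflexive twice-around)))
      where
      twice-around : z + (g + g) ≡ x + (s + t)
      twice-around = sym (begin
        x + (s + t)  ≡⟨ reassoc ⟩
        x + s + t    ≡⟨ cong (_+ t) a ⟩
        y + g + t    ≡⟨ sym (+-swap-g y t) ⟩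
        y + t + g    ≡⟨ cong (_+ g) b ⟩
        z + g + g    ≡⟨ +-assoc z g g ⟩
        z + (g + g)  ∎)
        where open ≡-Reasoning

  forward-split : ∀ {x y t u} → x < g → y < g → Forward x y t → u ≤ t →
    ∃ λ z → z < g × Forward x z (t ∸ u) × Forward z y u
  forward-split {x} {y} {t} {u} x<g y<g x→y u≤t = z , z<g , x→z , subst (λ w → Forward z w u) w≡y z→w
    where
    t<g : t < g
    t<g = proj₁ x→y
    u<g : u < g
    u<g = ≤-<-trans u≤t t<g
    t∸u<g : t ∸ u < g
    t∸u<g = ≤-<-trans (m∸n≤m t u) t<g
    t∸u+u≡t : t ∸ u + u ≡ t
    t∸u+u≡t = m∸n+n≡m u≤t
    z : ℕ
    z = shift x (t ∸ u)
    z<g : z < g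
    z<g = proj₁ (shift-forward x<g t∸u<g)
    x→z : Forward x z (t ∸ u)
    x→z = proj₂ (shift-forward x<g t∸u<g)
    w : ℕ
    w = shift z u
    z→w : Forward z w u
    z→w = proj₂ (shift-forward z<g u<g)
    -- Together these are t steps from x, so w is y.
    w≡y : w ≡ y
    w≡y = forward-target-unique (proj₁ (shift-forward z<g u<g)) y<g
      (subst (Forward x w) t∸u+u≡t (forward-compose x<g x→z z→w (subst (_< g) (sym t∸u+u≡t) t<g)))
      x→y

  forward-drop-first : ∀ {x z y s} → x < g → z < g → y < g →
    Forward x z 1 → Forward x y (suc s) → Forward z y s
  forward-drop-first {x} {z} {y} {s} x<g z<g y<g x→z x→y with forward-split x<g y<g x→y (n≤1+n s)
  ... | z' , z'<g , x→z' , z'→y = subst (λ q → Forward q y s) z'≡z z'→y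
    where
    z'≡z : z' ≡ z
    z'≡z = forward-target-unique z'<g z<g (subst (Forward x z') (m+n∸n≡m 1 s) x→z') x→z

  forward-drop-last : ∀ {j y x t} → j < g → y < g → x < g →
    Forward j y t → Forward x y 1 → 1 ≤ t → Forward j x (t ∸ 1)
  forward-drop-last j<g y<g x<g j→y x→y 1≤t with forward-split j<g y<g j→y 1≤t
  ... | z , z<g , j→z , z→y = subst (λ q → Forward _ q _) (forward-source-unique z<g x<g z→y x→y) j→z

  forward-last-step : ∀ {p y y' u} → p < g → y < g → y' < g →
    Forward p y u → Forward p y' (suc u) → Forward y y' 1
  forward-last-step p<g y<g y'<g p→y p→y' with forward-split p<g y'<g p→y' (s≤s z≤n)
  ... | z , z<g , p→z , z→y' = subst (λ q → Forward q _ 1) (forward-target-unique z<g y<g p→z p→y) z→y'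

  forward-difference : ∀ {i i' x t t'} → i < g → i' < g → x < g →
    Forward i x t → Forward i' x t' → t' ≤ t → Forward i i' (t ∸ t')
  forward-difference i<g i'<g x<g i→x i'→x t'≤t with forward-split i<g x<g i→x t'≤t
  ... | z , z<g , i→z , z→x = subst (λ q → Forward _ q _) (forward-source-unique z<g i'<g z→x i'→x) i→z

module CycleDistance (g : ℕ) where

  open CyclicShift g

  fwd : Fin g → Fin g → ℕ
  fwd i j = proj₁ (forward-exists (toℕ<n i) (toℕ<n j))

  fwd-forward : ∀ i j → Forward (toℕ i) (toℕ j) (fwd i j)
  fwd-forward i j = proj₂ (forward-exists (toℕ<n i) (toℕ<n j))

  fwd-unique : ∀ i j {s} → Forward (toℕ i) (toℕ j) s → fwd i j ≡ s
  fwd-unique i j = forward-steps-unique (fwd-forward i j)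

  fwd<g : ∀ i j → fwd i j < g
  fwd<g i j = proj₁ (fwd-forward i j)

  fwd-self : ∀ i → fwd i i ≡ 0
  fwd-self i = fwd-unique i i (forward-zero (≤-<-trans z≤n (toℕ<n i)))

  fwd-positive : ∀ {i j} → i ≢ j → 1 ≤ fwd i j
  fwd-positive {i} {j} i≢j = n≢0⇒n>0 λ fwd≡0 → i≢j (toℕ-injective
    (forward-zero⁻ (toℕ<n i) (subst (Forward (toℕ i) (toℕ j)) fwd≡0 (fwd-forward i j))))

  fwd-triangle : ∀ (a b d : Fin g) {s t} → Forward (toℕ a) (toℕ b) s → Forward (toℕ b) (toℕ d) t →
    fwd a d ≤ s + t
  fwd-triangle a b d {s} {t} a→b b→d with s + t <? g
  ... | yes s+t<g = ≤-reflexive (fwd-unique a d (forward-compose (toℕ<n a) a→b b→d s+t<g))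
  ... | no s+t≮g  = <⇒≤ (<-≤-trans (fwd<g a d) (≮⇒≥ s+t≮g))

  cyc : Fin g → Fin g → ℕ
  cyc i j = fwd i j ⊓ fwd j i

  cyc≤fwd : ∀ i j → cyc i j ≤ fwd i j
  cyc≤fwd i j = m⊓n≤m (fwd i j) (fwd j i)

  cyc-self : ∀ i → cyc i i ≡ 0
  cyc-self i = cong₂ _⊓_ (fwd-self i) (fwd-self i)

  cyc-tail≤suc-head : ∀ {x y} j → Forward (toℕ x) (toℕ y) 1 → cyc x j ≤ suc (cyc y j)
  cyc-tail≤suc-head {x} {y} j x→y with y ≟ᶠ j
  ... | yes refl = ≤-trans (cyc≤fwd x y) (≤-reflexive (trans (fwd-unique x y x→y) (cong suc (sym (cyc-self y)))))
  ... | no y≢j   = ⊓-mono-≤ x→j≤ j→x≤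
    where
    x→j≤ : fwd x j ≤ suc (fwd y j)
    x→j≤ = fwd-triangle x y j x→y (fwd-forward y j)
    j→x≤ : fwd j x ≤ suc (fwd j y)
    j→x≤ = begin
      fwd j x       ≡⟨ fwd-unique j x (forward-drop-last (toℕ<n j) (toℕ<n y) (toℕ<n x)
                         (fwd-forward j y) x→y (fwd-positive (λ j≡y → y≢j (sym j≡y)))) ⟩
      fwd j y ∸ 1   ≤⟨ m∸n≤m (fwd j y) 1 ⟩
      fwd j y       ≤⟨ n≤1+n _ ⟩
      suc (fwd j y) ∎
      where open ≤-Reasoning

  cyc-head≤suc-tail : ∀ {x y} j → Forward (toℕ x) (toℕ y) 1 → cyc y j ≤ suc (cyc x j)
  cyc-head≤suc-tail {x} {y} j x→y with x ≟ᶠ j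
  ... | yes refl = ≤-trans (m⊓n≤n (fwd y x) (fwd x y)) (≤-reflexive (trans (fwd-unique x y x→y) (cong suc (sym (cyc-self x)))))
  ... | no x≢j   = ⊓-mono-≤ y→j≤ j→y≤
    where
    1≤x→j : 1 ≤ fwd x j
    1≤x→j = fwd-positive x≢j
    y→j≤ : fwd y j ≤ suc (fwd x j)
    y→j≤ = begin
      fwd y j              ≡⟨ fwd-unique y j (forward-drop-first (toℕ<n x) (toℕ<n y) (toℕ<n j) x→y
                                (subst (Forward (toℕ x) (toℕ j)) (sym (suc-pred (fwd x j) {{>-nonZero 1≤x→j}})) (fwd-forward x j))) ⟩
      pred (fwd x j)       ≤⟨ pred[n]≤n ⟩
      fwd x j              ≤⟨ n≤1+n _ ⟩
      suc (fwd x j)        ∎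
      where open ≤-Reasoning
    j→y≤ : fwd j y ≤ suc (fwd j x)
    j→y≤ = ≤-trans (fwd-triangle j x y (fwd-forward j x) x→y) (≤-reflexive (+-comm (fwd j x) 1))

  cycAdj⇒forward : 1 < g → ∀ {i j : Fin g} → CycAdj i j → Forward (toℕ i) (toℕ j) 1
  cycAdj⇒forward 1<g {i} (inj₁ e) = 1<g , inj₁ (trans (+-comm (toℕ i) 1) (sym e))
  cycAdj⇒forward 1<g (inj₂ (i≡last , j≡0)) =
    1<g , inj₂ (trans (cong (_+ 1) i≡last) (trans (m∸n+n≡m (<⇒≤ 1<g)) (cong (_+ g) (sym j≡0))))

  forward⇒cycAdj : ∀ {i j : Fin g} → Forward (toℕ i) (toℕ j) 1 → CycAdj i j
  forward⇒cycAdj {i} (_ , inj₁ e) = inj₁ (sym (trans (+-comm 1 (toℕ i)) e))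
  forward⇒cycAdj {i} {j} (_ , inj₂ e) with toℕ j | toℕ<n i
  ... | zero  | _   = inj₂ (trans (sym (m+n∸n≡m (toℕ i) 1)) (cong (_∸ 1) e) , refl)
  ... | suc k | i<g = ⊥-elim (<⇒≱ (s≤s i<g)
    (≤-trans (m≤n+m (suc g) k) (≤-reflexive (trans (+-suc k g) (trans (sym e) (+-comm (toℕ i) 1))))))

loop-removal-length : ∀ {s t m} → s ≤ t → t ≤ m → s + (m ∸ t) + (t ∸ s) ≡ m
loop-removal-length {s} {t} {m} s≤t t≤m = begin
  s + (m ∸ t) + (t ∸ s)    ≡⟨ +-assoc s (m ∸ t) (t ∸ s) ⟩
  s + (m ∸ t + (t ∸ s))    ≡⟨ cong (s +_) (+-comm (m ∸ t) (t ∸ s)) ⟩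
  s + (t ∸ s + (m ∸ t))    ≡⟨ sym (+-assoc s (t ∸ s) (m ∸ t)) ⟩
  s + (t ∸ s) + (m ∸ t)    ≡⟨ cong (_+ (m ∸ t)) (m+[n∸m]≡n s≤t) ⟩
  t + (m ∸ t)              ≡⟨ m+[n∸m]≡n t≤m ⟩
  m                        ∎
  where open ≡-Reasoning

shortcut-shorter : ∀ {s t m} → s < t → t ≤ m → s + (m ∸ t) < m
shortcut-shorter {s} {t} {m} s<t t≤m = subst (s + (m ∸ t) <_) (m+[n∸m]≡n t≤m) (+-monoˡ-< (m ∸ t) s<t)

-- A walk of length m presented as the sequence of its vertices; this form is
-- convenient for cutting walks into pieces and splicing them.
record Path {n : ℕ} (R : Fin n → Fin n → Set) (u v : Fin n) (m : ℕ) : Set where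
  constructor path
  field
    at    : ℕ → Fin n
    start : at 0 ≡ u
    end   : at m ≡ v
    step  : ∀ k → k < m → R (at k) (at (suc k))

module _ {n : ℕ} {R : Fin n → Fin n → Set} where

  snoc : ∀ {u v w k} → Walk R u v k → R v w → Walk R u w (suc k)
  snoc nil e = cons e nil
  snoc (cons e' w) e = cons e' (snoc w e)

  reverse : (∀ {a b} → R a b → R b a) → ∀ {u v k} → Walk R u v k → Walk R v u k
  reverse R-sym nil = nil
  reverse R-sym (cons e w) = snoc (reverse R-sym w) (R-sym e)

  reach-snoc : ∀ {u v w} → Reach R u v → R v w → Reach R u w
  reach-snoc (k , w) e = suc k , snoc w e

  walk⇒path : ∀ {u v m} → Walk R u v m → Path R u v m
  walk⇒path {u} nil = path (λ _ → u) refl refl (λ _ ())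
  walk⇒path {u} {m = suc m} (cons e rest) = path at' refl end step'
    where
    open Path (walk⇒path rest)
    at' : ℕ → Fin n
    at' zero = u
    at' (suc k) = at k
    step' : ∀ k → k < suc m → R (at' k) (at' (suc k))
    step' zero _ = subst (R u) (sym start) e
    step' (suc k) (s≤s k<m) = step k k<m

  path-prefix : ∀ {u v w m} (P : Path R u v m) k → k ≤ m → Path.at P k ≡ w → Path R u w k
  path-prefix (path at start _ step) k k≤m at-k = path at start at-k (λ i i<k → step i (<-≤-trans i<k k≤m))

  path-suffix : ∀ {u v w m} (P : Path R u v m) k → k ≤ m → Path.at P k ≡ w → Path R w v (m ∸ k)
  path-suffix {m = m} (path at _ end step) k k≤m at-k =
    path (λ i → at (k + i)) (trans (cong at (+-identityʳ k)) at-k) (trans (cong at (m+[n∸m]≡n k≤m)) end)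
      (λ i i<m∸k → subst (λ j → R (at (k + i)) (at j)) (sym (+-suc k i))
        (step (k + i) (subst (k + i <_) (m+[n∸m]≡n k≤m) (+-monoʳ-< k i<m∸k))))

  path-shortcut : ∀ {u v m} (P : Path R u v m) s t → s < t → t ≤ m →
    Path.at P s ≡ Path.at P t → Path R u v (s + (m ∸ t))
  path-shortcut {u} {v} {m} (path at start end step) s t s<t t≤m loop = path at' start' end' step'
    where
    d : ℕ
    d = t ∸ s
    L : ℕ
    L = s + (m ∸ t)
    s+d≡t : s + d ≡ t
    s+d≡t = m+[n∸m]≡n (<⇒≤ s<t)
    L+d≡m : L + d ≡ m
    L+d≡m = loop-removal-length (<⇒≤ s<t) t≤m
    at' : ℕ → Fin n
    at' k with k ≤? s
    ... | yes _ = at k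
    ... | no _  = at (k + d)
    before : ∀ k → k ≤ s → at' k ≡ at k
    before k k≤s with k ≤? s
    ... | yes _ = refl
    ... | no k≰s = ⊥-elim (k≰s k≤s)
    after : ∀ k → s ≤ k → at' k ≡ at (k + d)
    after k s≤k with k ≤? s
    ... | no _ = refl
    ... | yes k≤s with ≤-antisym k≤s s≤k
    ...   | refl = trans loop (cong at (sym s+d≡t))
    start' : at' 0 ≡ u
    start' = trans (before 0 z≤n) start
    end' : at' L ≡ v
    end' = trans (after L (m≤m+n s _)) (trans (cong at L+d≡m) end)
    step' : ∀ k → k < L → R (at' k) (at' (suc k))
    step' k k<L = by-side (k <? s)
      where
      by-side : Dec (k < s) → R (at' k) (at' (suc k))
      by-side (yes k<s) = subst₂ R (sym (before k (<⇒≤ k<s))) (sym (before (suc k) k<s))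
                            (step k (<-≤-trans (<-trans k<s s<t) t≤m))
      by-side (no k≮s) = subst₂ R (sym (after k (≮⇒≥ k≮s))) (sym (after (suc k) (m≤n⇒m≤1+n (≮⇒≥ k≮s))))
                            (step (k + d) (subst (k + d <_) L+d≡m (+-monoˡ-< d k<L)))


cycAdj? : ∀ {g} (i j : Fin g) → Dec (CycAdj i j)
cycAdj? {g} i j = (toℕ j ≟ suc (toℕ i)) ⊎-dec ((toℕ i ≟ g ∸ 1) ×-dec (toℕ j ≟ 0))

cycleEdge? : ∀ {n g} (c : Fin g → Fin n) u v → Dec (CycleEdge c u v)
cycleEdge? c u v = any? λ i → any? λ j →
  cycAdj? i j ×-dec (((u ≟ᶠ c i) ×-dec (v ≟ᶠ c j)) ⊎-dec ((u ≟ᶠ c j) ×-dec (v ≟ᶠ c i)))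

module Unicyclic {n : ℕ} (G : Graph n) (g : ℕ) (c : Fin g → Fin n) (U : IsUnicyclicWith G g c) where

  open CyclicShift g
  open CycleDistance g

  connected : Connected G
  connected = proj₁ U

  3≤g : 3 ≤ g
  3≤g = proj₁ (proj₁ (proj₂ U))

  1<g : 1 < g
  1<g = ≤-trans (s≤s (s≤s z≤n)) 3≤g

  c-injective : Injective _≡_ _≡_ c
  c-injective = proj₁ (proj₂ (proj₁ (proj₂ U)))

  c-adjacent : ∀ i j → CycAdj i j → Adj G (c i) (c j)
  c-adjacent = proj₂ (proj₂ (proj₁ (proj₂ U)))

  only-cycle : ∀ g' (c' : Fin g' → Fin n) → IsCycle G g' c' → ∀ i j → CycAdj i j → CycleEdge c (c' i) (c' j)
  only-cycle = proj₂ (proj₂ U)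

  -- The graph H left after deleting the cycle edges; its components are the trees.
  H : Fin n → Fin n → Set
  H = AdjMinusCycle G c

  H-sym : ∀ {u v} → H u v → H v u
  H-sym (uv , not-cycle) = Graph.sym G uv , λ vu-cycle → not-cycle (flip-edge vu-cycle)
    where
    flip-edge : ∀ {u v} → CycleEdge c u v → CycleEdge c v u
    flip-edge (i , j , i~j , inj₁ (u≡ , v≡)) = i , j , i~j , inj₂ (v≡ , u≡)
    flip-edge (i , j , i~j , inj₂ (u≡ , v≡)) = i , j , i~j , inj₁ (v≡ , u≡)

  shiftᶠ : Fin g → (u : ℕ) → u < g → Fin g
  shiftᶠ p u u<g = fromℕ< (proj₁ (shift-forward (toℕ<n p) u<g))

  shiftᶠ-forward : ∀ p u (u<g : u < g) → Forward (toℕ p) (toℕ (shiftᶠ p u u<g)) u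
  shiftᶠ-forward p u u<g =
    subst (λ z → Forward (toℕ p) z u) (sym (toℕ-fromℕ< _)) (proj₂ (shift-forward (toℕ<n p) u<g))

  arc-walk : ∀ s (x y : Fin g) → Forward (toℕ x) (toℕ y) s → Walk (Adj G) (c x) (c y) s
  arc-walk zero x y x→y with toℕ-injective (forward-zero⁻ (toℕ<n x) x→y)
  ... | refl = nil
  arc-walk (suc s) x y x→y = cons (c-adjacent x z (forward⇒cycAdj x→z))
    (arc-walk s z y (forward-drop-first (toℕ<n x) (toℕ<n z) (toℕ<n y) x→z x→y))
    where
    z : Fin g
    z = shiftᶠ x 1 1<g
    x→z : Forward (toℕ x) (toℕ z) 1
    x→z = shiftᶠ-forward x 1 1<g

  cyc-walk : ∀ i j → Walk (Adj G) (c i) (c j) (cyc i j)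
  cyc-walk i j with fwd i j ≤? fwd j i
  ... | yes i→j≤j→i = subst (Walk (Adj G) (c i) (c j)) (sym (m≤n⇒m⊓n≡m i→j≤j→i))
                        (arc-walk _ i j (fwd-forward i j))
  ... | no i→j≰j→i  = subst (Walk (Adj G) (c i) (c j)) (sym (m≥n⇒m⊓n≡n (<⇒≤ (≰⇒> i→j≰j→i))))
                        (reverse (Graph.sym G) (arc-walk _ j i (fwd-forward j i)))

  -- An H-path from c a to c p (a ≢ p) that meets the cycle only at its ends and
  -- never repeats a vertex, followed by the forward arc from p back to a, is a
  -- cycle of G.  Since c is the only cycle, the first edge of the path must be
  -- a cycle edge.
  module ClosingCycle {a p m} (P : Path H (c a) (c p) m) (a≢p : a ≢ p) (0<m : 0 < m)
      (off-cycle : ∀ k q → 0 < k → k < m → Path.at P k ≢ c q)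
      (no-repeat : ∀ s t → s < t → t ≤ m → Path.at P s ≢ Path.at P t) where

    open Path P

    e : ℕ
    e = fwd p a

    1≤e : 1 ≤ e
    1≤e = fwd-positive (λ p≡a → a≢p (sym p≡a))

    g' : ℕ
    g' = m + e

    -- The cycle position u steps forward from p (only used for u < g).
    arc : ℕ → Fin g
    arc u with u <? g
    ... | yes u<g = shiftᶠ p u u<g
    ... | no _    = p

    arc-forward : ∀ u → u < g → Forward (toℕ p) (toℕ (arc u)) u
    arc-forward u u<g with u <? g
    ... | yes _   = shiftᶠ-forward p u u<g
    ... | no u≮g  = ⊥-elim (u≮g u<g)

    F : ℕ → Fin n
    F k with k ≤? m
    ... | yes _ = at k
    ... | no _  = c (arc (k ∸ m))

    F-path : ∀ k → k ≤ m → F k ≡ at k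
    F-path k k≤m with k ≤? m
    ... | yes _  = refl
    ... | no k≰m = ⊥-elim (k≰m k≤m)

    arc-steps<e : ∀ {k} → m ≤ k → k < g' → k ∸ m < e
    arc-steps<e m≤k k<g' = +-cancelˡ-< m _ _ (subst (_< g') (sym (m+[n∸m]≡n m≤k)) k<g')

    F-arc : ∀ k → m ≤ k → k < g' → ∃ λ y → F k ≡ c y × Forward (toℕ p) (toℕ y) (k ∸ m)
    F-arc k m≤k k<g' with k ≤? m
    ... | yes k≤m with ≤-antisym k≤m m≤k
    ...   | refl = p , end , subst (Forward (toℕ p) (toℕ p)) (sym (n∸n≡0 k)) (forward-zero (≤-<-trans z≤n (toℕ<n p)))
    F-arc k m≤k k<g' | no _ = arc (k ∸ m) , refl , arc-forward (k ∸ m) (<-trans (arc-steps<e m≤k k<g') (fwd<g p a))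

    -- A path vertex before time m is never an arc vertex (a only occurs at time 0
    -- and at the very end of the arc, which is not reached before g').
    path≢arc : ∀ k k' → k < m → m ≤ k' → k' < g' → F k ≢ F k'
    path≢arc k k' k<m m≤k' k'<g' Fk≡Fk' with F-arc k' m≤k' k'<g'
    ... | y , Fk'≡cy , p→y with k ≟ 0
    ...   | no k≢0   = off-cycle k y (n≢0⇒n>0 k≢0) k<m (trans (sym (F-path k (<⇒≤ k<m))) (trans Fk≡Fk' Fk'≡cy))
    ...   | yes refl = <⇒≢ (arc-steps<e m≤k' k'<g') (forward-steps-unique p→a (fwd-forward p a))
      where
      a≡y : a ≡ y
      a≡y = c-injective (trans (sym start) (trans (sym (F-path 0 z≤n)) (trans Fk≡Fk' Fk'≡cy)))
      p→a : Forward (toℕ p) (toℕ a) (k' ∸ m)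
      p→a = subst (λ z → Forward (toℕ p) (toℕ z) (k' ∸ m)) (sym a≡y) p→y

    path-injective : ∀ k k' → k ≤ m → k' ≤ m → at k ≡ at k' → k ≡ k'
    path-injective k k' k≤m k'≤m at≡ with <-cmp k k'
    ... | tri< k<k' _ _ = ⊥-elim (no-repeat k k' k<k' k'≤m at≡)
    ... | tri≈ _ k≡k' _ = k≡k'
    ... | tri> _ _ k'<k = ⊥-elim (no-repeat k' k k'<k k≤m (sym at≡))

    F-injective : ∀ k k' → k < g' → k' < g' → F k ≡ F k' → k ≡ k'
    F-injective k k' k<g' k'<g' Fk≡Fk' with k <? m | k' <? m
    ... | yes k<m | yes k'<m = path-injective k k' (<⇒≤ k<m) (<⇒≤ k'<m)
      (trans (sym (F-path k (<⇒≤ k<m))) (trans Fk≡Fk' (F-path k' (<⇒≤ k'<m))))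
    ... | yes k<m | no k'≮m  = ⊥-elim (path≢arc k k' k<m (≮⇒≥ k'≮m) k'<g' Fk≡Fk')
    ... | no k≮m  | yes k'<m = ⊥-elim (path≢arc k' k k'<m (≮⇒≥ k≮m) k<g' (sym Fk≡Fk'))
    ... | no k≮m  | no k'≮m with F-arc k (≮⇒≥ k≮m) k<g' | F-arc k' (≮⇒≥ k'≮m) k'<g'
    ...   | y , Fk≡cy , p→y | y' , Fk'≡cy' , p→y' with c-injective (trans (sym Fk≡cy) (trans Fk≡Fk' Fk'≡cy'))
    ...     | refl = begin
      k            ≡⟨ sym (m+[n∸m]≡n (≮⇒≥ k≮m)) ⟩
      m + (k ∸ m)  ≡⟨ cong (m +_) (forward-steps-unique p→y p→y') ⟩
      m + (k' ∸ m) ≡⟨ m+[n∸m]≡n (≮⇒≥ k'≮m) ⟩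
      k'           ∎
      where open ≡-Reasoning

    F-adjacent : ∀ k → suc k < g' → Adj G (F k) (F (suc k))
    F-adjacent k 1+k<g' = by-part (k <? m)
      where
      by-part : Dec (k < m) → Adj G (F k) (F (suc k))
      by-part (yes k<m) = subst₂ (Adj G) (sym (F-path k (<⇒≤ k<m))) (sym (F-path (suc k) k<m)) (proj₁ (step k k<m))
      by-part (no k≮m) with F-arc k (≮⇒≥ k≮m) (<-trans (n<1+n k) 1+k<g')
                          | F-arc (suc k) (m≤n⇒m≤1+n (≮⇒≥ k≮m)) 1+k<g'
      ... | y , Fk≡cy , p→y | y' , Fk'≡cy' , p→y' = subst₂ (Adj G) (sym Fk≡cy) (sym Fk'≡cy')
        (c-adjacent y y' (forward⇒cycAdj (forward-last-step (toℕ<n p) (toℕ<n y) (toℕ<n y') p→y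
          (subst (Forward (toℕ p) (toℕ y')) (+-∸-assoc 1 (≮⇒≥ k≮m)) p→y'))))

    m≤g'∸1 : m ≤ g' ∸ 1
    m≤g'∸1 = subst (m ≤_) (sym (+-∸-assoc m 1≤e)) (m≤m+n m _)

    g'∸1<g' : g' ∸ 1 < g'
    g'∸1<g' = ∸-monoʳ-< {g'} {1} {0} (s≤s z≤n) (≤-trans 1≤e (m≤n+m e m))

    F-closing : Adj G (F (g' ∸ 1)) (F 0)
    F-closing with F-arc (g' ∸ 1) m≤g'∸1 g'∸1<g'
    ... | y , F≡cy , p→y = subst₂ (Adj G) (sym F≡cy) (sym (trans (F-path 0 z≤n) start))
      (c-adjacent y a (forward⇒cycAdj (forward-last-step (toℕ<n p) (toℕ<n y) (toℕ<n a)
        (subst (Forward (toℕ p) (toℕ y)) last-steps p→y) (subst (Forward (toℕ p) (toℕ a)) e≡1+e∸1 (fwd-forward p a)))))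
      where
      last-steps : g' ∸ 1 ∸ m ≡ e ∸ 1
      last-steps = trans (cong (_∸ m) (+-∸-assoc m 1≤e)) (m+n∸m≡n m (e ∸ 1))
      e≡1+e∸1 : e ≡ suc (e ∸ 1)
      e≡1+e∸1 = sym (trans (+-comm 1 (e ∸ 1)) (m∸n+n≡m 1≤e))

    closed-walk-adjacent : ∀ (k k' : Fin g') → CycAdj k k' → Adj G (F (toℕ k)) (F (toℕ k'))
    closed-walk-adjacent k k' (inj₁ k'≡1+k) =
      subst (λ z → Adj G (F (toℕ k)) (F z)) (sym k'≡1+k) (F-adjacent (toℕ k) (subst (_< g') k'≡1+k (toℕ<n k')))
    closed-walk-adjacent k k' (inj₂ (k≡last , k'≡0)) =
      subst₂ (λ z z' → Adj G (F z) (F z')) (sym k≡last) (sym k'≡0) F-closing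

    first-edge-on-cycle : CycleEdge c (at 0) (at 1)
    first-edge-on-cycle with 3 ≤? g'
    ... | yes 3≤g' = subst₂ (CycleEdge c) (trans (cong F (toℕ-fromℕ< 0<g')) (F-path 0 z≤n))
                                          (trans (cong F (toℕ-fromℕ< 1<g')) (F-path 1 0<m))
      (only-cycle g' (λ k → F (toℕ k)) is-cycle (fromℕ< 0<g') (fromℕ< 1<g')
        (inj₁ (trans (toℕ-fromℕ< 1<g') (cong suc (sym (toℕ-fromℕ< 0<g'))))))
      where
      0<g' : 0 < g'
      0<g' = ≤-trans (s≤s z≤n) 3≤g'
      1<g' : 1 < g'
      1<g' = ≤-trans (s≤s (s≤s z≤n)) 3≤g'
      is-cycle : IsCycle G g' (λ k → F (toℕ k))
      is-cycle = 3≤g' , (λ {k} {k'} Fk≡Fk' → toℕ-injective (F-injective _ _ (toℕ<n k) (toℕ<n k') Fk≡Fk'))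
                      , closed-walk-adjacent
    -- A closed walk with fewer than three vertices: m = e = 1, so the path is
    -- the single cycle edge between p and a.
    ... | no 3≰g' = p , a , forward⇒cycAdj (subst (Forward (toℕ p) (toℕ a)) e≡1 (fwd-forward p a)) ,
                    inj₂ (start , trans (cong at (sym m≡1)) end)
      where
      g'≤2 : m + e ≤ 2
      g'≤2 = ≤-pred (≰⇒> 3≰g')
      m≡1 : m ≡ 1
      m≡1 = ≤-antisym (+-cancelʳ-≤ 1 m 1 (≤-trans (+-monoʳ-≤ m 1≤e) g'≤2)) 0<m
      e≡1 : e ≡ 1
      e≡1 = ≤-antisym (+-cancelˡ-≤ 1 e 1 (≤-trans (+-monoˡ-≤ e 0<m) g'≤2)) 1≤e

  interior-hit? : ∀ {u v m} (P : Path H u v m) →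
    Dec (∃ λ (k : Fin m) → ∃ λ q → 0 < toℕ k × Path.at P (toℕ k) ≡ c q)
  interior-hit? P = any? λ k → any? λ q → (0 <? toℕ k) ×-dec (Path.at P (toℕ k) ≟ᶠ c q)

  repetition? : ∀ {u v m} (P : Path H u v m) →
    Dec (∃ λ (s : Fin (suc m)) → ∃ λ (t : Fin (suc m)) → toℕ s < toℕ t × Path.at P (toℕ s) ≡ Path.at P (toℕ t))
  repetition? P = any? λ s → any? λ t → (toℕ s <? toℕ t) ×-dec (Path.at P (toℕ s) ≟ᶠ Path.at P (toℕ t))

  Separated : ℕ → Set
  Separated m = ∀ a p → Path H (c a) (c p) m → a ≡ p

  -- Strong induction step: a shortest H-path between distinct cycle vertices
  -- would meet the cycle only at its ends and never repeat a vertex, so by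
  -- 'ClosingCycle' its first edge would be a cycle edge, which H excludes.
  no-bridge : ∀ m → WfRec _<_ Separated m → ∀ {a p} → Path H (c a) (c p) m → a ≢ p → ⊥
  no-bridge zero _ P a≢p = a≢p (c-injective (trans (sym (Path.start P)) (Path.end P)))
  no-bridge (suc m) IH {a} {p} P a≢p with interior-hit? P
  ... | yes (k , q , 0<k , at-k) = a≢p (trans (IH (toℕ<n k) a q (path-prefix P (toℕ k) k≤m at-k))
                                              (IH (∸-monoʳ-< 0<k k≤m) q p (path-suffix P (toℕ k) k≤m at-k)))
    where
    k≤m : toℕ k ≤ suc m
    k≤m = <⇒≤ (toℕ<n k)
  ... | no no-hit with repetition? P
  ...   | yes (s , t , s<t , loop) =
    a≢p (IH (shortcut-shorter s<t t≤m) a p (path-shortcut P (toℕ s) (toℕ t) s<t t≤m loop))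
    where
    t≤m : toℕ t ≤ suc m
    t≤m = ≤-pred (toℕ<n t)
  ...   | no no-rep = proj₂ (Path.step P 0 (s≤s z≤n))
    (ClosingCycle.first-edge-on-cycle P a≢p (s≤s z≤n) off-cycle no-repeat)
    where
    off-cycle : ∀ k q → 0 < k → k < suc m → Path.at P k ≢ c q
    off-cycle k q 0<k k<m at-k = no-hit (fromℕ< k<m , q , subst (0 <_) (sym (toℕ-fromℕ< k<m)) 0<k ,
                                         subst (λ z → Path.at P z ≡ c q) (sym (toℕ-fromℕ< k<m)) at-k)
    no-repeat : ∀ s t → s < t → t ≤ suc m → Path.at P s ≢ Path.at P t
    no-repeat s t s<t t≤m loop = no-rep (fromℕ< (s≤s (≤-trans (<⇒≤ s<t) t≤m)) , fromℕ< (s≤s t≤m) ,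
      subst₂ _<_ (sym (toℕ-fromℕ< _)) (sym (toℕ-fromℕ< _)) s<t ,
      subst₂ (λ x y → Path.at P x ≡ Path.at P y) (sym (toℕ-fromℕ< _)) (sym (toℕ-fromℕ< _)) loop)

  separated : ∀ m → Separated m
  separated = <-rec Separated λ m IH a p P → decidable-stable (a ≟ᶠ p) (no-bridge m IH P)

  trees-disjoint : ∀ a p → Reach H (c a) (c p) → a ≡ p
  trees-disjoint a p (m , w) = separated m a p (walk⇒path w)

  -- A walk from the tree of a to c j has length at least cyc a j: it can only
  -- move between trees along cycle edges, each changing cyc by at most one.
  walk-length-bound : ∀ a j {v m} → Reach H (c a) v → Walk (Adj G) v (c j) m → cyc a j ≤ m
  walk-length-bound a j a⇝v nil with trees-disjoint a j a⇝v
  ... | refl = ≤-reflexive (cyc-self a)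
  walk-length-bound a j {v} a⇝v (cons {w = w} vw rest) with cycleEdge? c v w
  ... | no not-cycle = m≤n⇒m≤1+n (walk-length-bound a j (reach-snoc a⇝v (vw , not-cycle)) rest)
  ... | yes (i , i' , i~i' , inj₁ (refl , refl)) with trees-disjoint a i a⇝v
  ...   | refl = ≤-trans (cyc-tail≤suc-head j (cycAdj⇒forward 1<g i~i')) (s≤s (walk-length-bound i' j (0 , nil) rest))
  walk-length-bound a j a⇝v (cons vw rest) | yes (i , i' , i~i' , inj₂ (refl , refl)) with trees-disjoint a i' a⇝v
  ...   | refl = ≤-trans (cyc-head≤suc-tail j (cycAdj⇒forward 1<g i~i')) (s≤s (walk-length-bound i j (0 , nil) rest))

  cycle-distance : ∀ i j → Dist G (c i) (c j) (cyc i j)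
  cycle-distance i j = cyc-walk i j , λ m w → walk-length-bound i j (0 , nil) w

ifYes : ∀ {Q : Set} → Dec Q → ℕ → ℕ
ifYes (yes _) k = k
ifYes (no _)  _ = 0

module _ {A : Set} where

  remove : ∀ {x} (ys : List A) → x ∈ ys → List A
  remove (y ∷ ys) (here _) = ys
  remove (y ∷ ys) (there x∈ys) = y ∷ remove ys x∈ys

  length-remove : ∀ {x} (ys : List A) (x∈ys : x ∈ ys) → length ys ≡ suc (length (remove ys x∈ys))
  length-remove (y ∷ ys) (here _) = refl
  length-remove (y ∷ ys) (there x∈ys) = cong suc (length-remove ys x∈ys)

  ∈-remove : ∀ {x y} {ys : List A} (x∈ys : x ∈ ys) → y ∈ ys → y ≢ x → y ∈ remove ys x∈ys
  ∈-remove (here x≡) (here y≡) y≢x = ⊥-elim (y≢x (trans y≡ (sym x≡)))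
  ∈-remove (there _) (here y≡) _ = here y≡
  ∈-remove (here _) (there y∈ys) _ = y∈ys
  ∈-remove (there x∈ys) (there y∈ys) y≢x = there (∈-remove x∈ys y∈ys y≢x)

  unique-length-≤ : ∀ (xs ys : List A) → Unique xs → (∀ {x} → x ∈ xs → x ∈ ys) → length xs ≤ length ys
  unique-length-≤ [] ys _ _ = z≤n
  unique-length-≤ (x ∷ xs) ys (x∉xs ∷ xs-unique) xs⊆ys =
    subst (suc (length xs) ≤_) (sym (length-remove ys x∈ys)) (s≤s (unique-length-≤ xs _ xs-unique xs⊆rest))
    where
    x∈ys : x ∈ ys
    x∈ys = xs⊆ys (here refl)
    xs⊆rest : ∀ {z} → z ∈ xs → z ∈ remove ys x∈ys
    xs⊆rest z∈xs = ∈-remove x∈ys (xs⊆ys (there z∈xs)) (λ z≡x → All.lookup x∉xs z∈xs (sym z≡x))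

  sum-map-+ : (f h : A → ℕ) → ∀ xs → sum (map (λ x → f x + h x) xs) ≡ sum (map f xs) + sum (map h xs)
  sum-map-+ f h [] = refl
  sum-map-+ f h (x ∷ xs) = begin
    f x + h x + sum (map (λ x → f x + h x) xs)     ≡⟨ cong (f x + h x +_) (sum-map-+ f h xs) ⟩
    f x + h x + (sum (map f xs) + sum (map h xs))  ≡⟨ +-assoc (f x) (h x) _ ⟩
    f x + (h x + (sum (map f xs) + sum (map h xs))) ≡⟨ cong (f x +_) (+-comm (h x) _) ⟩
    f x + (sum (map f xs) + sum (map h xs) + h x)  ≡⟨ cong (f x +_) (+-assoc (sum (map f xs)) _ _) ⟩
    f x + (sum (map f xs) + (sum (map h xs) + h x)) ≡⟨ cong (λ z → f x + (sum (map f xs) + z)) (+-comm _ (h x)) ⟩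
    f x + (sum (map f xs) + (h x + sum (map h xs))) ≡⟨ sym (+-assoc (f x) _ _) ⟩
    f x + sum (map f xs) + (h x + sum (map h xs))  ∎
    where open ≡-Reasoning

  sum-map-mono : (f h : A → ℕ) → (∀ x → f x ≤ h x) → ∀ xs → sum (map f xs) ≤ sum (map h xs)
  sum-map-mono f h f≤h [] = z≤n
  sum-map-mono f h f≤h (x ∷ xs) = +-mono-≤ (f≤h x) (sum-map-mono f h f≤h xs)

  sum-map-* : (k : ℕ) (f : A → ℕ) → ∀ xs → sum (map (λ x → k * f x) xs) ≡ k * sum (map f xs)
  sum-map-* k f [] = sym (*-zeroʳ k)
  sum-map-* k f (x ∷ xs) = trans (cong (k * f x +_) (sum-map-* k f xs)) (sym (*-distribˡ-+ k (f x) _))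

  sum-map-1 : ∀ xs → sum (map (λ (_ : A) → 1) xs) ≡ length xs
  sum-map-1 [] = refl
  sum-map-1 (x ∷ xs) = cong suc (sum-map-1 xs)

  length-filter-sum : ∀ {P : A → Set} (P? : Decidable P) xs →
    length (filter P? xs) ≡ sum (map (λ x → ifYes (P? x) 1) xs)
  length-filter-sum P? [] = refl
  length-filter-sum P? (x ∷ xs) with P? x
  ... | yes _ = cong suc (length-filter-sum P? xs)
  ... | no _  = length-filter-sum P? xs

module _ {A B : Set} where

  length-concat-map : (f : A → List B) → ∀ xs → length (concat (map f xs)) ≡ sum (map (λ x → length (f x)) xs)
  length-concat-map f [] = refl
  length-concat-map f (x ∷ xs) = trans (length-++ (f x)) (cong (length (f x) +_) (length-concat-map f xs))

-- The arc
-- of i consists of the s i positions i, i+1, …, i + s i - 1; the hypothesis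
-- s i ≤ fwd i j says that it ends before the start of any other nonempty arc j.
module ArcPacking (g : ℕ) (s : Fin g → ℕ) (s≤g : ∀ i → s i ≤ g)
    (ends-before : ∀ i j → i ≢ j → 0 < s j → s i ≤ CycleDistance.fwd g i j) where

  open CyclicShift g
  open CycleDistance g

  arc : Fin g → List ℕ
  arc i = applyUpTo (shift (toℕ i)) (s i)

  arc-forward : ∀ i {t} → t < s i → shift (toℕ i) t < g × Forward (toℕ i) (shift (toℕ i) t) t
  arc-forward i t<s = shift-forward (toℕ<n i) (<-≤-trans t<s (s≤g i))

  arc-unique : ∀ i → Unique (arc i)
  arc-unique i = applyUpTo⁺₁ (shift (toℕ i)) (s i) λ {t} {t'} t<t' t'<s same →
    <⇒≢ t<t' (forward-steps-unique (proj₂ (arc-forward i (<-trans t<t' t'<s)))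
      (subst (λ z → Forward (toℕ i) z t') (sym same) (proj₂ (arc-forward i t'<s))))

  -- If the arcs of i ≢ j met, with j's position t' ≤ t steps in and i's t steps in,
  -- then j would lie t ∸ t' < s i steps forward from i.
  arcs-do-not-meet : ∀ i j {t t'} → i ≢ j → t < s i → t' < s j →
    shift (toℕ i) t ≡ shift (toℕ j) t' → t' ≤ t → ⊥
  arcs-do-not-meet i j {t} {t'} i≢j t<s t'<s meet t'≤t = <⇒≱ (≤-<-trans fwd≤t t<s) (ends-before i j i≢j (≤-<-trans z≤n t'<s))
    where
    i→x : shift (toℕ i) t < g × Forward (toℕ i) (shift (toℕ i) t) t
    i→x = arc-forward i t<s
    j→x : Forward (toℕ j) (shift (toℕ i) t) t'
    j→x = subst (λ z → Forward (toℕ j) z t') (sym meet) (proj₂ (arc-forward j t'<s))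
    fwd≤t : fwd i j ≤ t
    fwd≤t = ≤-trans (≤-reflexive (fwd-unique i j (forward-difference (toℕ<n i) (toℕ<n j) (proj₁ i→x) (proj₂ i→x) j→x t'≤t)))
                    (m∸n≤m t t')

  arcs-disjoint : ∀ {i j} → i ≢ j → Disjoint (arc i) (arc j)
  arcs-disjoint {i} {j} i≢j (x∈i , x∈j) with ∈-applyUpTo⁻ (shift (toℕ i)) x∈i | ∈-applyUpTo⁻ (shift (toℕ j)) x∈j
  ... | t , t<s , refl | t' , t'<s , meet with ≤-total t' t
  ...   | inj₁ t'≤t = arcs-do-not-meet i j i≢j t<s t'<s meet t'≤t
  ...   | inj₂ t≤t' = arcs-do-not-meet j i (λ j≡i → i≢j (sym j≡i)) t'<s t<s (sym meet) t≤t'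

  all-arcs : List ℕ
  all-arcs = concat (map arc (allFin g))

  all-arcs-unique : Unique all-arcs
  all-arcs-unique = concat⁺ (Allₚ.map⁺ (All.universal arc-unique (allFin g)))
                            (AllPairsₚ.map⁺ (AllPairs.map arcs-disjoint (allFin⁺ g)))

  all-arcs⊆positions : ∀ {x} → x ∈ all-arcs → x ∈ upTo g
  all-arcs⊆positions x∈ with ∈-concat⁻′ (map arc (allFin g)) x∈
  ... | xs , x∈xs , xs∈ with ∈-map⁻ arc xs∈
  ...   | i , _ , refl with ∈-applyUpTo⁻ (shift (toℕ i)) x∈xs
  ...     | t , t<s , refl = ∈-upTo⁺ (proj₁ (arc-forward i t<s))

  arc-packing : sum (map s (allFin g)) ≤ g
  arc-packing = begin
    sum (map s (allFin g))                          ≡⟨ cong sum (map-cong (λ i → sym (length-applyUpTo _ (s i))) (allFin g)) ⟩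
    sum (map (λ i → length (arc i)) (allFin g))     ≡⟨ sym (length-concat-map arc (allFin g)) ⟩
    length all-arcs                                 ≤⟨ unique-length-≤ all-arcs (upTo g) all-arcs-unique all-arcs⊆positions ⟩
    length (upTo g)                                 ≡⟨ length-applyUpTo (λ x → x) g ⟩
    g                                               ∎
    where open ≤-Reasoning

module Trees {n : ℕ} (G : Graph n) (g : ℕ) (c : Fin g → Fin n) (U : IsUnicyclicWith G g c)
    (l : Fin g → ℕ) (tree-size : ∀ i → TreeSize G c i (l i)) where

  open Unicyclic G g c U

  tree : Fin g → List (Fin n)
  tree i = proj₁ (tree-size i)

  tree-sound : ∀ i {v} → v ∈ tree i → Reach H (c i) v
  tree-sound i {v} = proj₁ (proj₁ (proj₂ (proj₂ (tree-size i))) v)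

  tree-complete : ∀ i {v} → Reach H (c i) v → v ∈ tree i
  tree-complete i {v} = proj₂ (proj₁ (proj₂ (proj₂ (tree-size i))) v)

  tree-length : ∀ i → length (tree i) ≡ suc (l i)
  tree-length i = proj₂ (proj₂ (proj₂ (tree-size i)))

  -- Follow a walk to the cycle: the first cycle edge on it starts at a cycle
  -- vertex, and before that the walk stays in one tree.
  in-some-tree : ∀ {i₀ v k} → Walk (Adj G) v (c i₀) k → ∃ λ a → v ∈ tree a
  in-some-tree {i₀} nil = i₀ , tree-complete i₀ (0 , nil)
  in-some-tree {v = v} (cons {w = w} vw rest) with cycleEdge? c v w
  ... | yes (i , _ , _ , inj₁ (refl , _)) = i , tree-complete i (0 , nil)
  ... | yes (_ , j , _ , inj₂ (refl , _)) = j , tree-complete j (0 , nil)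
  ... | no not-cycle with in-some-tree rest
  ...   | a , w∈a = a , tree-complete a (reach-snoc (tree-sound a w∈a) (H-sym (vw , not-cycle)))

  vertex-count : n ≤ sum (map l (allFin g)) + g
  vertex-count = begin
    n                                                   ≡⟨ sym (length-tabulate {n = n} (λ v → v)) ⟩
    length (allFin n)                                   ≤⟨ unique-length-≤ (allFin n) _ (allFin⁺ n) covered ⟩
    length (concat (map tree (allFin g)))               ≡⟨ length-concat-map tree (allFin g) ⟩
    sum (map (λ i → length (tree i)) (allFin g))        ≡⟨ cong sum (map-cong (λ i → trans (tree-length i) (+-comm 1 (l i))) (allFin g)) ⟩
    sum (map (λ i → l i + 1) (allFin g))                ≡⟨ sum-map-+ l (λ _ → 1) (allFin g) ⟩
    sum (map l (allFin g)) + sum (map (λ _ → 1) (allFin g)) ≡⟨ cong (sum (map l (allFin g)) +_) (trans (sum-map-1 (allFin g)) (length-tabulate (λ i → i))) ⟩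
    sum (map l (allFin g)) + g                          ∎
    where
    open ≤-Reasoning
    i₀ : Fin g
    i₀ = fromℕ< (≤-trans (s≤s z≤n) 3≤g)
    covered : ∀ {v} → v ∈ allFin n → v ∈ concat (map tree (allFin g))
    covered {v} _ with in-some-tree (proj₂ (connected v (c i₀)))
    ... | a , v∈a = ∈-concat⁺′ v∈a (∈-map⁺ tree (∈-allFin a))

-- The counting argument: if every two members of C_G are further apart on the
-- cycle than a threshold h(l_i), the arcs of length h(l_i) + 1 starting at the
-- members of C_G are disjoint, which bounds the tree sizes and hence n.
module Counting {n : ℕ} (G : Graph n) (g : ℕ) (c : Fin g → Fin n) (U : IsUnicyclicWith G g c)
    (l : Fin g → ℕ) (tree-size : ∀ i → TreeSize G c i (l i)) where

  open Unicyclic G g c U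
  open CycleDistance g
  open Trees G g c U l tree-size

  indicator : Fin g → ℕ
  indicator i = ifYes (1 ≤? l i) 1

  cardC-sum : cardC l ≡ sum (map indicator (allFin g))
  cardC-sum = length-filter-sum (λ i → 1 ≤? l i) (allFin g)

  two-in-C : 2 ≤ cardC l → ∃ λ b → ∃ λ b' → b ≢ b' × 1 ≤ l b × 1 ≤ l b'
  two-in-C = pick (filter (λ i → 1 ≤? l i) (allFin g)) (filter⁺ (λ i → 1 ≤? l i) (allFin⁺ g))
    (λ b∈ → proj₂ (∈-filter⁻ (λ i → 1 ≤? l i) {xs = allFin g} b∈))
    where
    pick : ∀ bs → Unique bs → (∀ {b} → b ∈ bs → 1 ≤ l b) → 2 ≤ length bs →
      ∃ λ b → ∃ λ b' → b ≢ b' × 1 ≤ l b × 1 ≤ l b'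
    pick []           _ _ ()
    pick (_ ∷ [])     _ _ (s≤s ())
    pick (b ∷ b' ∷ _) ((b≢b' ∷ _) ∷ _) in-C _ = b , b' , b≢b' , in-C (here refl) , in-C (there (here refl))

  module _ (h : ℕ → ℕ) (K : ℕ) (h-large : ∀ x → x < K * suc (h x))
      (far : ∀ i j → i ≢ j → 1 ≤ l i → 1 ≤ l j → h (l i) < cyc i j)
      (b b' : Fin g) (b≢b' : b ≢ b') (b∈C : 1 ≤ l b) (b'∈C : 1 ≤ l b') where

    span : Fin g → ℕ
    span i = ifYes (1 ≤? l i) (suc (h (l i)))

    span-ends-before : ∀ i j → i ≢ j → 0 < span j → span i ≤ fwd i j
    span-ends-before i j i≢j 0<span with 1 ≤? l i | 1 ≤? l j
    ... | yes i∈C | yes j∈C = ≤-trans (far i j i≢j i∈C j∈C) (cyc≤fwd i j)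
    ... | no _    | _       = z≤n
    ... | yes _   | no _    = ⊥-elim (<-irrefl refl 0<span)

    span-positive : ∀ j → 1 ≤ l j → 0 < span j
    span-positive j j∈C with 1 ≤? l j
    ... | yes _   = s≤s z≤n
    ... | no j∉C = ⊥-elim (j∉C j∈C)

    -- Another member of C_G keeps each arc shorter than the cycle.
    span≤g : ∀ i → span i ≤ g
    span≤g i with i ≟ᶠ b
    ... | yes refl = <⇒≤ (≤-<-trans (span-ends-before i b' b≢b' (span-positive b' b'∈C)) (fwd<g i b'))
    ... | no i≢b   = <⇒≤ (≤-<-trans (span-ends-before i b i≢b (span-positive b b∈C)) (fwd<g i b))

    tree-vs-span : ∀ i → l i + indicator i ≤ K * span i
    tree-vs-span i with 1 ≤? l i
    ... | yes _    = subst (_≤ K * suc (h (l i))) (+-comm 1 (l i)) (h-large (l i))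
    ... | no i∉C   = ≤-trans (≤-reflexive (+-identityʳ (l i))) (≤-trans (≤-pred (≰⇒> i∉C)) z≤n)

    trees-vs-cycle : sum (map l (allFin g)) + cardC l ≤ K * g
    trees-vs-cycle = begin
      sum (map l (allFin g)) + cardC l                             ≡⟨ cong (sum (map l (allFin g)) +_) cardC-sum ⟩
      sum (map l (allFin g)) + sum (map indicator (allFin g))      ≡⟨ sym (sum-map-+ l indicator (allFin g)) ⟩
      sum (map (λ i → l i + indicator i) (allFin g))               ≤⟨ sum-map-mono _ _ tree-vs-span (allFin g) ⟩
      sum (map (λ i → K * span i) (allFin g))                      ≡⟨ sum-map-* K span (allFin g) ⟩
      K * sum (map span (allFin g))                                ≤⟨ *-monoʳ-≤ K (ArcPacking.arc-packing g span span≤g span-ends-before) ⟩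
      K * g                                                        ∎
      where open ≤-Reasoning

    -- Hence n + |C_G| ≤ (K + 1) g, which contradicts n ≥ (K + 1) g - 1 and |C_G| ≥ 2.
    too-many-vertices : suc K * g ∸ 1 ≤ n → 2 ≤ cardC l → ⊥
    too-many-vertices n-large 2≤r = <-irrefl refl (begin-strict
      suc K * g                              ≡⟨ sym (m∸n+n≡m 1≤g') ⟩
      suc K * g ∸ 1 + 1                      <⟨ +-monoʳ-< (suc K * g ∸ 1) ≤-refl ⟩
      suc K * g ∸ 1 + 2                      ≤⟨ +-mono-≤ n-large 2≤r ⟩
      n + cardC l                            ≤⟨ +-monoˡ-≤ (cardC l) vertex-count ⟩
      Σl + g + cardC l                       ≡⟨ +-assoc Σl g (cardC l) ⟩
      Σl + (g + cardC l)                     ≡⟨ cong (Σl +_) (+-comm g (cardC l)) ⟩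
      Σl + (cardC l + g)                     ≡⟨ sym (+-assoc Σl (cardC l) g) ⟩
      Σl + cardC l + g                       ≤⟨ +-monoˡ-≤ g trees-vs-cycle ⟩
      K * g + g                              ≡⟨ +-comm (K * g) g ⟩
      suc K * g                              ∎)
      where
      open ≤-Reasoning
      Σl : ℕ
      Σl = sum (map l (allFin g))
      1≤g' : 1 ≤ suc K * g
      1≤g' = ≤-trans (≤-trans (s≤s z≤n) 3≤g) (m≤m+n g (K * g))

  close-pair : (h : ℕ → ℕ) (K : ℕ) → (∀ x → x < K * suc (h x)) → 2 ≤ cardC l → suc K * g ∸ 1 ≤ n →
    ∃ λ i → ∃ λ j → (i ≢ j) × (1 ≤ l i) × (1 ≤ l j) × ∃ λ k → Dist G (c i) (c j) k × (k ≤ h (l i))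
  close-pair h K h-large 2≤r n-large
    with any? (λ i → any? λ j → ¬? (i ≟ᶠ j) ×-dec (1 ≤? l i) ×-dec (1 ≤? l j) ×-dec (cyc i j ≤? h (l i)))
  ... | yes (i , j , i≢j , i∈C , j∈C , close) = i , j , i≢j , i∈C , j∈C , cyc i j , cycle-distance i j , close
  ... | no none with two-in-C 2≤r
  ...   | b , b' , b≢b' , b∈C , b'∈C = ⊥-elim (too-many-vertices h K h-large far b b' b≢b' b∈C b'∈C n-large 2≤r)
    where
    far : ∀ i j → i ≢ j → 1 ≤ l i → 1 ≤ l j → h (l i) < cyc i j
    far i j i≢j i∈C j∈C = ≰⇒> λ close → none (i , j , i≢j , i∈C , j∈C , close)

double-half≤ : ∀ x → 2 * ⌊ x /2⌋ ≤ x
double-half≤ x = begin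
  2 * ⌊ x /2⌋          ≡⟨ cong (⌊ x /2⌋ +_) (+-identityʳ ⌊ x /2⌋) ⟩
  ⌊ x /2⌋ + ⌊ x /2⌋    ≤⟨ +-monoʳ-≤ ⌊ x /2⌋ (⌊n/2⌋≤⌈n/2⌉ x) ⟩
  ⌊ x /2⌋ + ⌈ x /2⌉    ≡⟨ ⌊n/2⌋+⌈n/2⌉≡n x ⟩
  x                    ∎
  where open ≤-Reasoning

<double-suc-half : ∀ x → x < 2 * suc ⌊ x /2⌋
<double-suc-half zero = s≤s z≤n
<double-suc-half (suc zero) = s≤s (s≤s z≤n)
<double-suc-half (suc (suc x)) =
  subst (suc (suc x) <_) (sym (*-suc 2 (suc ⌊ x /2⌋))) (s≤s (s≤s (<double-suc-half x)))

lemma4p1 : ∀ (n : ℕ) (G : Graph n) (g : ℕ) (c : Fin g → Fin n) →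
  IsUnicyclicWith G g c →
  (l : Fin g → ℕ) → (∀ i → TreeSize G c i (l i)) →
  (r : ℕ) → r ≡ cardC l → 2 ≤ r →
  ((2 * g ∸ 1 ≤ n →
    ∃ λ i → ∃ λ j → (i ≢ j) × (1 ≤ l i) × (1 ≤ l j) ×
      ∃ λ k → Dist G (c i) (c j) k × (k ≤ l i))
  × (3 * g ∸ 1 ≤ n →
    ∃ λ i → ∃ λ j → (i ≢ j) × (1 ≤ l i) × (1 ≤ l j) ×
      ∃ λ k → Dist G (c i) (c j) k × (2 * k ≤ l i)))
lemma4p1 n G g c U l tree-size r refl 2≤r =
  close-pair (λ x → x) 1 (λ x → ≤-reflexive (sym (*-identityˡ (suc x)))) 2≤r , part-b
  where
  open Counting G g c U l tree-size using (close-pair)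

  part-b : 3 * g ∸ 1 ≤ n → ∃ λ i → ∃ λ j → (i ≢ j) × (1 ≤ l i) × (1 ≤ l j) ×
    ∃ λ k → Dist G (c i) (c j) k × (2 * k ≤ l i)
  part-b n-large with close-pair ⌊_/2⌋ 2 <double-suc-half 2≤r n-large
  ... | i , j , i≢j , i∈C , j∈C , k , d , k≤half = i , j , i≢j , i∈C , j∈C , k , d , ≤-trans (*-monoʳ-≤ 2 k≤half) (double-half≤ (l i))
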